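{- Let $X$ and $Y$ be finite disjoint sets. The mapping $$\tau_{X,Y} : \mathfrak{U}(X,Y)\to\mathfrak{U}(X,Y),\qquad R \mapsto (R|_X)^d \cup \big((X\times Y)\setminus R\big) \cup (R|_Y)^d$$ is a well-defined self-inverse bijection. Moreover, for every subset $Z \subseteq Y$ and every partial order relation $Q$ on $Z$, $\tau_{X,Y}$ induces a self-inverse bijection between $\mathfrak{U}(X,Y)\cap\mathfrak{C}_Q(X\cup(Y\setminus Z), Z)$ and $\mathfrak{U}(X,Y)\cap\mathfrak{C}_{Q^d}(X\cup(Y\setminus Z),Z)$; in particular (for $Z = Y$), between $\mathfrak{M}_Q(X,Y)$ and $\mathfrak{M}_{Q^d}(X,Y)$.
   Context: A partial order relation (p.o.r.) on $S$ is a reflexive, antisymmetric, transitive subset of $S\times S$; $\mathfrak{P}(S)$ is the set of p.o.r.s on $S$. $R|_M = R\cap(M\times M)$; $R^d = \{(b,a):(a,b)\in R\}$. Upper end: $U$ with $u\in U$, $(u,x)\in R\Rightarrow x\in U$. Convex: $(a,x),(x,b)\in R$, $a,b\in M$ imply $x\in M$. For disjoint sets $A,B$ and a p.o.r. $Q'$ on $B$: $\mathfrak{U}(A,B) = \{R\in\mathfrak{P}(A\cup B) : B \text{ is an upper end of } R\}$; $\mathfrak{C}_{Q'}(A,B) = \{R\in\mathfrak{P}(A\cup B) : R|_B = Q',\ B\text{ convex in } R\}$; $\mathfrak{M}_{Q'}(A,B) = \mathfrak{U}(A,B)\cap\mathfrak{C}_{Q'}(A,B)$. -}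

module Defs where

open import Data.Nat using (ℕ)
open import Data.Fin using (Fin)
open import Data.Bool using (Bool; true; false; not; T)
open import Data.Sum using (_⊎_; inj₁; inj₂)
open import Data.Product using (_×_)
open import Data.Empty using (⊥)
open import Relation.Binary.PropositionalEquality using (_≡_)

-- The finite disjoint sets X = Fin m and Y = Fin n; their (disjoint) union X ∪ Y.
Elem : ℕ → ℕ → Set
Elem m n = Fin m ⊎ Fin n

BRel : Set → Set
BRel A = A → A → Bool

Sub : Set → Set
Sub A = A → Bool

IsPORon : {A : Set} → Sub A → BRel A → Set
IsPORon {A} S R =
  ((a b : A) → T (R a b) → T (S a) × T (S b)) ×
  ((a : A) → T (S a) → T (R a a)) ×
  ((a b : A) → T (R a b) → T (R b a) → a ≡ b) ×
  ((a b c : A) → T (R a b) → T (R b c) → T (R a c))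

IsPOR : {A : Set} → BRel A → Set
IsPOR R = IsPORon (λ _ → true) R

dual : {A : Set} → BRel A → BRel A
dual Q a b = Q b a

-- R ∈ 𝔘(X,Y): R is a p.o.r. on X ∪ Y and Y is an upper end of R.
InU : {m n : ℕ} → BRel (Elem m n) → Set
InU {m} {n} R = IsPOR R × ((y : Fin n) (x : Fin m) → T (R (inj₂ y) (inj₁ x)) → ⊥)

onY : {m n : ℕ} → Sub (Fin n) → Sub (Elem m n)
onY Z (inj₁ _) = false
onY Z (inj₂ y) = Z y

-- R ∈ 𝔆_Q(X ∪ (Y∖Z), Z), for R already a p.o.r. on X ∪ Y:
-- R|_Z = Q and Z is convex in R.
InC : {m n : ℕ} → (Z : Sub (Fin n)) → BRel (Fin n) → BRel (Elem m n) → Set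
InC {m} {n} Z Q R =
  IsPOR R ×
  ((y y' : Fin n) → T (Z y) → T (Z y') → R (inj₂ y) (inj₂ y') ≡ Q y y') ×
  ((a c b : Elem m n) → T (onY Z a) → T (onY Z b) →
      T (R a c) → T (R c b) → T (onY Z c))

-- R ∈ 𝔐_Q(X,Y) = 𝔘(X,Y) ∩ 𝔆_Q(X,Y), Q a relation on Y.
-- (R|_Y = Q and Y convex in R.)
InM : {m n : ℕ} → BRel (Fin n) → BRel (Elem m n) → Set
InM {m} {n} Q R =
  InU R ×
  IsPOR R ×
  ((y y' : Fin n) → R (inj₂ y) (inj₂ y') ≡ Q y y') ×
  ((a c b : Elem m n) → T (onY (λ _ → true) a) → T (onY (λ _ → true) b) →
      T (R a c) → T (R c b) → T (onY (λ _ → true) c))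

tau : {m n : ℕ} → BRel (Elem m n) → BRel (Elem m n)
tau R (inj₁ a) (inj₁ b) = R (inj₁ b) (inj₁ a)
tau R (inj₁ a) (inj₂ b) = not (R (inj₁ a) (inj₂ b))
tau R (inj₂ a) (inj₁ b) = false
tau R (inj₂ a) (inj₂ b) = R (inj₂ b) (inj₂ a)

-- As τ R relates no element of Y to one of X, the only
-- transitivity instances of τ R that mix X and Y have the shape x ≤ x' ≤ y or
-- x ≤ y ≤ y', and each is the contrapositive of an instance for R. Complementing
-- X × Y twice gives back R, and the upper end Y ensures that the Y × X part,
-- which τ sets to empty, was empty already. On a subset Z of Y, τ R is the dual
-- of R, so both R|_Z = Q and convexity of Z carry over with Q replaced by Q^d.
module Submission where

open import Defs
open import Data.Nat using (ℕ)
open import Data.Fin using (Fin)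
open import Data.Bool using (true; false; not; T)
open import Data.Bool.Properties using (not-involutive; T-not-≡)
open import Data.Sum using (inj₁; inj₂)
open import Data.Product using (_×_; _,_; proj₁; proj₂)
open import Data.Unit using (tt)
open import Function.Bundles using (Equivalence)
open import Relation.Nullary using (¬_; contradiction)
open import Relation.Binary.PropositionalEquality using (_≡_; refl; sym)

¬T⇒T-not : ∀ {b} → ¬ T b → T (not b)
¬T⇒T-not {true}  ¬b = contradiction tt ¬b
¬T⇒T-not {false} _  = tt

T-not⇒¬T : ∀ {b} → T (not b) → ¬ T b
T-not⇒¬T {true}  ()
T-not⇒¬T {false} _ ()

module _ {m n : ℕ} where

  UpperEndY : BRel (Elem m n) → Set
  UpperEndY R = (y : Fin n) (x : Fin m) → ¬ T (R (inj₂ y) (inj₁ x))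

  RestrictsTo : Sub (Fin n) → BRel (Fin n) → BRel (Elem m n) → Set
  RestrictsTo Z Q R =
    (y y' : Fin n) → T (Z y) → T (Z y') → R (inj₂ y) (inj₂ y') ≡ Q y y'

  ConvexIn : Sub (Fin n) → BRel (Elem m n) → Set
  ConvexIn Z R = (a c b : Elem m n) → T (onY Z a) → T (onY Z b) →
    T (R a c) → T (R c b) → T (onY Z c)

  tau-upperEndY : (R : BRel (Elem m n)) → UpperEndY (tau R)
  tau-upperEndY R y x ()

  module _ {R : BRel (Elem m n)} (isPOR : IsPOR R) where
    private
      R-refl  = proj₁ (proj₂ isPOR)
      R-anti  = proj₁ (proj₂ (proj₂ isPOR))
      R-trans = proj₂ (proj₂ (proj₂ isPOR))

    tau-refl : (a : Elem m n) → T true → T (tau R a a)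
    tau-refl (inj₁ x) _ = R-refl (inj₁ x) tt
    tau-refl (inj₂ y) _ = R-refl (inj₂ y) tt

    tau-antisym : (a b : Elem m n) → T (tau R a b) → T (tau R b a) → a ≡ b
    tau-antisym (inj₁ x) (inj₁ x') p q = sym (R-anti _ _ p q)
    tau-antisym (inj₁ x) (inj₂ y)  p ()
    tau-antisym (inj₂ y) (inj₁ x)  ()
    tau-antisym (inj₂ y) (inj₂ y') p q = sym (R-anti _ _ p q)

    tau-trans : (a b c : Elem m n) → T (tau R a b) → T (tau R b c) → T (tau R a c)
    tau-trans (inj₁ x) (inj₁ x') (inj₁ x'') p q = R-trans _ _ _ q p
    tau-trans (inj₁ x) (inj₁ x') (inj₂ y) p q =
      ¬T⇒T-not (λ x≤y → T-not⇒¬T q (R-trans _ _ _ p x≤y))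
    tau-trans (inj₁ x) (inj₂ y) (inj₂ y') p q =
      ¬T⇒T-not (λ x≤y' → T-not⇒¬T p (R-trans _ _ _ x≤y' q))
    tau-trans (inj₁ x) (inj₂ y) (inj₁ x') p ()
    tau-trans (inj₂ y) (inj₁ x) c ()
    tau-trans (inj₂ y) (inj₂ y') (inj₁ x) p ()
    tau-trans (inj₂ y) (inj₂ y') (inj₂ y'') p q = R-trans _ _ _ q p

    tau-isPOR : IsPOR (tau R)
    tau-isPOR = (λ _ _ _ → tt , tt) , tau-refl , tau-antisym , tau-trans

  tau-InU : {R : BRel (Elem m n)} → InU R → InU (tau R)
  tau-InU {R} (isPOR , _) = tau-isPOR isPOR , tau-upperEndY R

  tau-involutive : {R : BRel (Elem m n)} → UpperEndY R →
    (a b : Elem m n) → tau (tau R) a b ≡ R a b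
  tau-involutive up (inj₁ x) (inj₁ x') = refl
  tau-involutive up (inj₁ x) (inj₂ y)  = not-involutive _
  tau-involutive up (inj₂ y) (inj₁ x)  =
    sym (Equivalence.to T-not-≡ (¬T⇒T-not (up y x)))
  tau-involutive up (inj₂ y) (inj₂ y') = refl

  tau-restrictsTo-dual : {Z : Sub (Fin n)} {Q : BRel (Fin n)} {R : BRel (Elem m n)} →
    RestrictsTo Z Q R → RestrictsTo Z (dual Q) (tau R)
  tau-restrictsTo-dual R|Z≡Q y y' zy zy' = R|Z≡Q y' y zy' zy

  tau-convexIn : {Z : Sub (Fin n)} {R : BRel (Elem m n)} →
    ConvexIn Z R → ConvexIn Z (tau R)
  tau-convexIn convex (inj₂ y) (inj₂ y') (inj₂ y'') zy zy'' p q =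
    convex (inj₂ y'') (inj₂ y') (inj₂ y) zy'' zy q p
  tau-convexIn convex (inj₂ y) (inj₁ x) b zy zb ()
  tau-convexIn convex (inj₂ y) (inj₂ y') (inj₁ x) zy ()
  tau-convexIn convex (inj₁ x) c b ()

  tau-InC : {Z : Sub (Fin n)} {Q : BRel (Fin n)} {R : BRel (Elem m n)} →
    InC Z Q R → InC Z (dual Q) (tau R)
  tau-InC {R = R} (isPOR , R|Z≡Q , convex) =
    tau-isPOR isPOR , tau-restrictsTo-dual {R = R} R|Z≡Q , tau-convexIn {R = R} convex

  tau-InM : {Q : BRel (Fin n)} {R : BRel (Elem m n)} → InM Q R → InM (dual Q) (tau R)
  tau-InM {R = R} (inU , isPOR , R|Y≡Q , convex) =
    tau-InU inU , tau-isPOR isPOR , (λ y y' → R|Y≡Q y' y) , tau-convexIn {R = R} convex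

lemma3 : (m n : ℕ) →
    ((R : BRel (Elem m n)) → InU R → InU (tau R)) ×
    ((R : BRel (Elem m n)) → InU R → (a b : Elem m n) → tau (tau R) a b ≡ R a b) ×
    ((Z : Sub (Fin n)) (Q : BRel (Fin n)) → IsPORon Z Q →
      ((R : BRel (Elem m n)) → InU R → InC Z Q R → InU (tau R) × InC Z (dual Q) (tau R)) ×
      ((R : BRel (Elem m n)) → InU R → InC Z (dual Q) R → InU (tau R) × InC Z Q (tau R))) ×
    ((Q : BRel (Fin n)) → IsPOR Q →
      ((R : BRel (Elem m n)) → InM Q R → InM (dual Q) (tau R)) ×
      ((R : BRel (Elem m n)) → InM (dual Q) R → InM Q (tau R)))
lemma3 m n =
  (λ R → tau-InU) ,
  (λ R inU → tau-involutive (proj₂ inU)) ,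
  (λ Z Q _ → (λ R inU inC → tau-InU inU , tau-InC inC)
           , (λ R inU inC → tau-InU inU , tau-InC inC)) ,
  (λ Q _ → (λ R → tau-InM) , (λ R → tau-InM))
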